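{- Let $r$ be a positive integer. For all integers $0\le k\le n$, \[ u_r(n,k)=\sum_{i=k}^{n}\binom{i}{k}(-r)^{i-k}\,u(n,i), \qquad u(n,k)=\sum_{i=k}^{n}\binom{i}{k}r^{i-k}\,u_r(n,i). \]
   Context: For a nonnegative integer $r$, the numbers $u_r(n,k)$ ($n,k\ge 0$ integers) are defined by $u_r(n,k)=u_r(n-1,k-1)-((n-1)^2+r)\,u_r(n-1,k)$ for $n\ge k\ge 1$, with $u_r(n,0)=(-1)^n\prod_{i=0}^{n-1}(i^2+r)$, $u_r(0,k)=\delta_{k0}$, and $u_r(n,k)=0$ for $k>n$. The central factorial numbers with even indices of the first kind are $u(n,k):=u_0(n,k)$ (equivalently $u(n,k)=t(2n,2k)$ where $t$ are the central factorial numbers of the first kind). -}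

module Defs where

open import Data.Nat as ℕ using (ℕ; zero; suc; _∸_)
open import Data.Bool using (true; false)
open import Data.Nat.Combinatorics using (_C_)
open import Data.Integer using (ℤ; +_; -_; _+_; _*_; _-_; 1ℤ; 0ℤ)
open import Data.Integer using () renaming (_^_ to _^ℤ_)

uR : ℕ → ℕ → ℕ → ℤ
uR r zero zero = 1ℤ
uR r zero (suc k) = 0ℤ
uR r (suc n) zero = - (+ (n ℕ.* n ℕ.+ r)) * uR r n zero
uR r (suc n) (suc k) = uR r n k - (+ (n ℕ.* n ℕ.+ r)) * uR r n (suc k)

u : ℕ → ℕ → ℤ
u = uR 0

sumUpTo : ℕ → (ℕ → ℤ) → ℤ
sumUpTo zero f = f 0
sumUpTo (suc m) f = sumUpTo m f + f (suc m)

ΣFrom : ℕ → ℕ → (ℕ → ℤ) → ℤ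
ΣFrom k n f with n ℕ.<ᵇ k
... | true = 0ℤ
... | false = sumUpTo (n ∸ k) (λ j → f (k ℕ.+ j))

module Submission where

open import Defs
open import Data.Nat as ℕ using (ℕ; _≤_; _∸_; NonZero)
open import Data.Nat.Combinatorics using (_C_)
open import Data.Integer using (ℤ; +_; -_; _*_; _^_)
open import Data.Product using (_×_)
open import Relation.Binary.PropositionalEquality using (_≡_)

open import Data.Bool using (true; false)
import Data.Bool as Bool
open import Data.Empty using (⊥-elim)
open import Data.Integer using (_+_; _-_; 0ℤ)
import Data.Integer.Properties as ℤ
open import Data.Integer.Tactic.RingSolver using (solve-∀)
open import Data.Nat using (zero; suc; _<_; s≤s; z≤n)
open import Data.Nat.Combinatorics using (nCk+nC[k+1]≡[n+1]C[k+1]; k>n⇒nCk≡0)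
import Data.Nat.Properties as ℕ
open import Data.Product using (_,_)
open import Data.Unit using (tt)
open import Relation.Nullary using (yes; no)
open import Relation.Binary.PropositionalEquality
  using (refl; sym; trans; cong; cong₂; subst; module ≡-Reasoning)
open ≡-Reasoning

-- The numbers u_r(n,k) are the coefficients of x^k in ∏_{i<n} (x - (i² + r)).
-- Substituting x ↦ x + a in ∏_{i<n} (x - c i) gives ∏_{i<n} (x - (c i - a)), and
-- comparing coefficients via the binomial theorem yields
--   Σ_i C(i,k) a^{i-k} [x^i] ∏ (x - c i) = [x^k] ∏ (x - (c i - a)).
-- Both identities are instances, with a = -r resp. a = r, since the roots of the
-- two products differ by exactly r.

sumUpTo-unfoldˡ : ∀ n f → sumUpTo (suc n) f ≡ f 0 + sumUpTo n (λ j → f (suc j))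
sumUpTo-unfoldˡ zero    f = refl
sumUpTo-unfoldˡ (suc n) f =
  trans (cong (_+ f (suc (suc n))) (sumUpTo-unfoldˡ n f)) (ℤ.+-assoc (f 0) _ _)

sumUpTo-cong : ∀ n {f g : ℕ → ℤ} → (∀ i → f i ≡ g i) → sumUpTo n f ≡ sumUpTo n g
sumUpTo-cong zero    f≡g = f≡g 0
sumUpTo-cong (suc n) f≡g = cong₂ _+_ (sumUpTo-cong n f≡g) (f≡g (suc n))

sumUpTo-+ : ∀ n f g → sumUpTo n (λ i → f i + g i) ≡ sumUpTo n f + sumUpTo n g
sumUpTo-+ zero    f g = refl
sumUpTo-+ (suc n) f g =
  trans (cong (_+ (f (suc n) + g (suc n))) (sumUpTo-+ n f g))
        (interchange (sumUpTo n f) (sumUpTo n g) (f (suc n)) (g (suc n)))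
  where
  interchange : ∀ a b c d → (a + b) + (c + d) ≡ (a + c) + (b + d)
  interchange = solve-∀

sumUpTo-*ˡ : ∀ n c f → sumUpTo n (λ i → c * f i) ≡ c * sumUpTo n f
sumUpTo-*ˡ zero    c f = refl
sumUpTo-*ˡ (suc n) c f =
  trans (cong (_+ c * f (suc n)) (sumUpTo-*ˡ n c f)) (sym (ℤ.*-distribˡ-+ c _ _))

sumUpTo-dropZeros : ∀ k m f → (∀ i → i < k → f i ≡ 0ℤ) →
                    sumUpTo (k ℕ.+ m) f ≡ sumUpTo m (λ j → f (k ℕ.+ j))
sumUpTo-dropZeros zero    m f f<k≡0 = refl
sumUpTo-dropZeros (suc k) m f f<k≡0 = begin
  sumUpTo (suc (k ℕ.+ m)) f
    ≡⟨ sumUpTo-unfoldˡ (k ℕ.+ m) f ⟩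
  f 0 + sumUpTo (k ℕ.+ m) (λ j → f (suc j))
    ≡⟨ cong₂ _+_ (f<k≡0 0 (s≤s z≤n))
                 (sumUpTo-dropZeros k m (λ j → f (suc j)) (λ i i<k → f<k≡0 (suc i) (s≤s i<k))) ⟩
  0ℤ + sumUpTo m (λ j → f (suc k ℕ.+ j))
    ≡⟨ ℤ.+-identityˡ _ ⟩
  sumUpTo m (λ j → f (suc k ℕ.+ j)) ∎

ΣFrom≡sumUpTo : ∀ k n f → k ≤ n → (∀ i → i < k → f i ≡ 0ℤ) → ΣFrom k n f ≡ sumUpTo n f
ΣFrom≡sumUpTo k n f k≤n f<k≡0 with n ℕ.<ᵇ k in n<ᵇk
... | true  = ⊥-elim (ℕ.<⇒≱ (ℕ.<ᵇ⇒< n k (subst Bool.T (sym n<ᵇk) tt)) k≤n)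
... | false = begin
  sumUpTo (n ∸ k) (λ j → f (k ℕ.+ j)) ≡⟨ sumUpTo-dropZeros k (n ∸ k) f f<k≡0 ⟨
  sumUpTo (k ℕ.+ (n ∸ k)) f           ≡⟨ cong (λ m → sumUpTo m f) (ℕ.m+[n∸m]≡n k≤n) ⟩
  sumUpTo n f ∎

ΣFrom-cong : ∀ k n {f g : ℕ → ℤ} → (∀ i → f i ≡ g i) → ΣFrom k n f ≡ ΣFrom k n g
ΣFrom-cong k n f≡g with n ℕ.<ᵇ k
... | true  = refl
... | false = sumUpTo-cong (n ∸ k) (λ j → f≡g (k ℕ.+ j))

binomWeight : ℤ → ℕ → ℕ → ℤ
binomWeight a k i = + (i C k) * a ^ (i ∸ k)

binomWeight-below : ∀ a {k i} → i < k → binomWeight a k i ≡ 0ℤ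
binomWeight-below a {k} {i} i<k = cong (λ m → + m * a ^ (i ∸ k)) (k>n⇒nCk≡0 i<k)

binomWeight-suc-zero : ∀ a j → binomWeight a 0 (suc j) ≡ a * binomWeight a 0 j
binomWeight-suc-zero a j = swap a (a ^ j)
  where
  swap : ∀ a x → + 1 * (a * x) ≡ a * (+ 1 * x)
  swap = solve-∀

binomWeight-lowerExponent : ∀ a k j → + (j C suc k) * a ^ (j ∸ k) ≡ a * binomWeight a (suc k) j
binomWeight-lowerExponent a k j with suc k ℕ.≤? j
... | yes k<j rewrite ℕ.+-∸-assoc 1 k<j = swap (+ (j C suc k)) a (a ^ (j ∸ suc k))
  where
  swap : ∀ c a x → c * (a * x) ≡ a * (c * x)
  swap = solve-∀
... | no k≮j rewrite k>n⇒nCk≡0 (ℕ.≰⇒> k≮j) = sym (ℤ.*-zeroʳ a)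

binomWeight-pascal : ∀ a k j →
  binomWeight a (suc k) (suc j) ≡ binomWeight a k j + a * binomWeight a (suc k) j
binomWeight-pascal a k j = begin
  + (suc j C suc k) * a ^ (j ∸ k)
    ≡⟨ cong (λ m → + m * a ^ (j ∸ k)) (nCk+nC[k+1]≡[n+1]C[k+1] j k) ⟨
  + (j C k ℕ.+ j C suc k) * a ^ (j ∸ k)
    ≡⟨ cong (_* a ^ (j ∸ k)) (ℤ.pos-+ (j C k) (j C suc k)) ⟩
  (+ (j C k) + + (j C suc k)) * a ^ (j ∸ k)
    ≡⟨ ℤ.*-distribʳ-+ (a ^ (j ∸ k)) (+ (j C k)) (+ (j C suc k)) ⟩
  binomWeight a k j + + (j C suc k) * a ^ (j ∸ k)
    ≡⟨ cong (λ y → binomWeight a k j + y) (binomWeight-lowerExponent a k j) ⟩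
  binomWeight a k j + a * binomWeight a (suc k) j ∎

weightedSum : ℤ → ℕ → ℕ → (ℕ → ℤ) → ℤ
weightedSum a k n x = sumUpTo n (λ i → binomWeight a k i * x i)

weightedSum-shift-zero : ∀ a n x →
  sumUpTo n (λ j → binomWeight a 0 (suc j) * x j) ≡ a * weightedSum a 0 n x
weightedSum-shift-zero a n x = begin
  sumUpTo n (λ j → binomWeight a 0 (suc j) * x j)
    ≡⟨ sumUpTo-cong n (λ j → trans (cong (_* x j) (binomWeight-suc-zero a j)) (ℤ.*-assoc a _ _)) ⟩
  sumUpTo n (λ j → a * (binomWeight a 0 j * x j))
    ≡⟨ sumUpTo-*ˡ n a _ ⟩
  a * weightedSum a 0 n x ∎

weightedSum-shift-suc : ∀ a k n x →
  sumUpTo n (λ j → binomWeight a (suc k) (suc j) * x j)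
    ≡ weightedSum a k n x + a * weightedSum a (suc k) n x
weightedSum-shift-suc a k n x = begin
  sumUpTo n (λ j → binomWeight a (suc k) (suc j) * x j)
    ≡⟨ sumUpTo-cong n (λ j → trans (cong (_* x j) (binomWeight-pascal a k j))
                                   (distrib (binomWeight a k j) a (binomWeight a (suc k) j) (x j))) ⟩
  sumUpTo n (λ j → binomWeight a k j * x j + a * (binomWeight a (suc k) j * x j))
    ≡⟨ sumUpTo-+ n _ _ ⟩
  weightedSum a k n x + sumUpTo n (λ j → a * (binomWeight a (suc k) j * x j))
    ≡⟨ cong (λ y → weightedSum a k n x + y) (sumUpTo-*ˡ n a _) ⟩
  weightedSum a k n x + a * weightedSum a (suc k) n x ∎
  where
  distrib : ∀ g a h x → (g + a * h) * x ≡ g * x + a * (h * x)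
  distrib = solve-∀

-- prodCoeff c n k is the coefficient of x^k in ∏_{i<n} (x - c i).
prodCoeff : (ℕ → ℤ) → ℕ → ℕ → ℤ
prodCoeff c zero    zero    = + 1
prodCoeff c zero    (suc k) = 0ℤ
prodCoeff c (suc n) zero    = - c n * prodCoeff c n zero
prodCoeff c (suc n) (suc k) = prodCoeff c n k - c n * prodCoeff c n (suc k)

prodCoeff-cong : ∀ {c d} → (∀ m → c m ≡ d m) → ∀ n k → prodCoeff c n k ≡ prodCoeff d n k
prodCoeff-cong c≡d zero    zero    = refl
prodCoeff-cong c≡d zero    (suc k) = refl
prodCoeff-cong c≡d (suc n) zero    =
  cong₂ (λ x y → - x * y) (c≡d n) (prodCoeff-cong c≡d n zero)
prodCoeff-cong c≡d (suc n) (suc k) =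
  cong₂ _-_ (prodCoeff-cong c≡d n k) (cong₂ _*_ (c≡d n) (prodCoeff-cong c≡d n (suc k)))

prodCoeff-aboveDegree : ∀ c {n k} → n < k → prodCoeff c n k ≡ 0ℤ
prodCoeff-aboveDegree c {zero}  {suc k} _         = refl
prodCoeff-aboveDegree c {suc n} {suc k} (s≤s n<k) = begin
  prodCoeff c n k - c n * prodCoeff c n (suc k)
    ≡⟨ cong₂ (λ x y → x - c n * y) (prodCoeff-aboveDegree c n<k)
                                   (prodCoeff-aboveDegree c (ℕ.m<n⇒m<1+n n<k)) ⟩
  0ℤ - c n * 0ℤ
    ≡⟨ vanish (c n) ⟩
  0ℤ ∎
  where
  vanish : ∀ x → 0ℤ - x * 0ℤ ≡ 0ℤ
  vanish = solve-∀

uR≡prodCoeff : ∀ r n k → uR r n k ≡ prodCoeff (λ m → + (m ℕ.* m ℕ.+ r)) n k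
uR≡prodCoeff r zero    zero    = refl
uR≡prodCoeff r zero    (suc k) = refl
uR≡prodCoeff r (suc n) zero    = cong (- + (n ℕ.* n ℕ.+ r) *_) (uR≡prodCoeff r n zero)
uR≡prodCoeff r (suc n) (suc k) =
  cong₂ (λ x y → x - + (n ℕ.* n ℕ.+ r) * y) (uR≡prodCoeff r n k) (uR≡prodCoeff r n (suc k))

module _ (c : ℕ → ℤ) (a : ℤ) where

  private
    T : ℕ → ℕ → ℤ
    T n k = weightedSum a k n (prodCoeff c n)

  weightedSum-prodCoeff-suc : ∀ n k →
    T (suc n) k ≡ sumUpTo n (λ j → binomWeight a k (suc j) * prodCoeff c n j) - c n * T n k
  weightedSum-prodCoeff-suc n k = begin
    T (suc n) k
      ≡⟨ sumUpTo-unfoldˡ n _ ⟩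
    W 0 * (- c n * p 0) + sumUpTo n (λ j → W (suc j) * (p j - c n * p (suc j)))
      ≡⟨ cong (λ y → W 0 * (- c n * p 0) + y) (sumUpTo-cong n (λ j → expand (W (suc j)) (p j) (c n) (p (suc j)))) ⟩
    W 0 * (- c n * p 0) + sumUpTo n (λ j → W (suc j) * p j + (- c n) * (W (suc j) * p (suc j)))
      ≡⟨ cong (λ y → W 0 * (- c n * p 0) + y) (trans (sumUpTo-+ n _ _) (cong (λ y → S + y) (sumUpTo-*ˡ n (- c n) _))) ⟩
    W 0 * (- c n * p 0) + (S + (- c n) * S′)
      ≡⟨ collect (W 0) (c n) (p 0) S S′ ⟩
    S - c n * (W 0 * p 0 + S′)
      ≡⟨ cong (λ x → S - c n * x) (sym (sumUpTo-unfoldˡ n (λ i → W i * p i))) ⟩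
    S - c n * (T n k + W (suc n) * p (suc n))
      ≡⟨ cong (λ x → S - c n * (T n k + W (suc n) * x)) (prodCoeff-aboveDegree c (ℕ.n<1+n n)) ⟩
    S - c n * (T n k + W (suc n) * 0ℤ)
      ≡⟨ cong (λ x → S - c n * x) (trans (cong (λ y → T n k + y) (ℤ.*-zeroʳ (W (suc n)))) (ℤ.+-identityʳ (T n k))) ⟩
    S - c n * T n k ∎
    where
    W = binomWeight a k
    p = prodCoeff c n
    S = sumUpTo n (λ j → W (suc j) * p j)
    S′ = sumUpTo n (λ j → W (suc j) * p (suc j))
    expand : ∀ w x c y → w * (x - c * y) ≡ w * x + (- c) * (w * y)
    expand = solve-∀
    collect : ∀ w c x s s′ → w * (- c * x) + (s + (- c) * s′) ≡ s - c * (w * x + s′)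
    collect = solve-∀

  weightedSum-prodCoeff : ∀ n k → T n k ≡ prodCoeff (λ m → c m - a) n k
  weightedSum-prodCoeff zero    zero    = refl
  weightedSum-prodCoeff zero    (suc k) = refl
  weightedSum-prodCoeff (suc n) zero    = begin
    T (suc n) 0                  ≡⟨ weightedSum-prodCoeff-suc n 0 ⟩
    S - c n * T n 0              ≡⟨ cong (_- c n * T n 0) (weightedSum-shift-zero a n (prodCoeff c n)) ⟩
    a * T n 0 - c n * T n 0      ≡⟨ regroup a (c n) (T n 0) ⟩
    - (c n - a) * T n 0          ≡⟨ cong (- (c n - a) *_) (weightedSum-prodCoeff n 0) ⟩
    prodCoeff (λ m → c m - a) (suc n) 0 ∎
    where
    S = sumUpTo n (λ j → binomWeight a 0 (suc j) * prodCoeff c n j)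
    regroup : ∀ a c t → a * t - c * t ≡ - (c - a) * t
    regroup = solve-∀
  weightedSum-prodCoeff (suc n) (suc k) = begin
    T (suc n) (suc k)
      ≡⟨ weightedSum-prodCoeff-suc n (suc k) ⟩
    S - c n * T n (suc k)
      ≡⟨ cong (_- c n * T n (suc k)) (weightedSum-shift-suc a k n (prodCoeff c n)) ⟩
    T n k + a * T n (suc k) - c n * T n (suc k)
      ≡⟨ regroup (T n k) a (c n) (T n (suc k)) ⟩
    T n k - (c n - a) * T n (suc k)
      ≡⟨ cong₂ (λ x y → x - (c n - a) * y) (weightedSum-prodCoeff n k) (weightedSum-prodCoeff n (suc k)) ⟩
    prodCoeff (λ m → c m - a) (suc n) (suc k) ∎
    where
    S = sumUpTo n (λ j → binomWeight a (suc k) (suc j) * prodCoeff c n j)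
    regroup : ∀ t a c s → t + a * s - c * s ≡ t - (c - a) * s
    regroup = solve-∀

uR-binomialShift : ∀ s t a → + t ≡ + s - a → ∀ n k → k ≤ n →
  uR t n k ≡ ΣFrom k n (λ i → + (i C k) * a ^ (i ∸ k) * uR s n i)
uR-binomialShift s t a t≡s-a n k k≤n = begin
  uR t n k
    ≡⟨ uR≡prodCoeff t n k ⟩
  prodCoeff (sq t) n k
    ≡⟨ prodCoeff-cong sq-shift n k ⟩
  prodCoeff (λ m → sq s m - a) n k
    ≡⟨ weightedSum-prodCoeff (sq s) a n k ⟨
  weightedSum a k n (prodCoeff (sq s) n)
    ≡⟨ ΣFrom≡sumUpTo k n _ k≤n (λ i i<k → cong (_* prodCoeff (sq s) n i) (binomWeight-below a i<k)) ⟨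
  ΣFrom k n (λ i → binomWeight a k i * prodCoeff (sq s) n i)
    ≡⟨ ΣFrom-cong k n (λ i → cong (binomWeight a k i *_) (uR≡prodCoeff s n i)) ⟨
  ΣFrom k n (λ i → binomWeight a k i * uR s n i) ∎
  where
  sq : ℕ → ℕ → ℤ
  sq r m = + (m ℕ.* m ℕ.+ r)
  sq-shift : ∀ m → sq t m ≡ sq s m - a
  sq-shift m = begin
    + (m ℕ.* m ℕ.+ t)       ≡⟨ ℤ.pos-+ (m ℕ.* m) t ⟩
    + (m ℕ.* m) + + t       ≡⟨ cong (λ y → + (m ℕ.* m) + y) t≡s-a ⟩
    + (m ℕ.* m) + (+ s - a) ≡⟨ ℤ.+-assoc (+ (m ℕ.* m)) (+ s) (- a) ⟨
    + (m ℕ.* m) + + s - a   ≡⟨ cong (_- a) (ℤ.pos-+ (m ℕ.* m) s) ⟨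
    sq s m - a ∎

mainTheorem7 : (r : ℕ) → .{{_ : NonZero r}} → (n k : ℕ) → k ≤ n →
    (uR r n k ≡ ΣFrom k n (λ i → (+ (i C k)) * ((- (+ r)) ^ (i ∸ k)) * u n i))
    × (u n k ≡ ΣFrom k n (λ i → (+ (i C k)) * ((+ r) ^ (i ∸ k)) * uR r n i))
mainTheorem7 r n k k≤n =
  uR-binomialShift 0 r (- + r) (r≡0+r (+ r)) n k k≤n ,
  uR-binomialShift r 0 (+ r) (sym (ℤ.+-inverseʳ (+ r))) n k k≤n
  where
  r≡0+r : ∀ x → x ≡ 0ℤ - - x
  r≡0+r = solve-∀
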